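{- Let $(\delta,K_1,K_2,C_0,C_1)$ be admissible, let $M$ be a magic distance, and let $\mathbf C$ be a $\delta$-edge-labelled cycle with a tension. Then: (1) if $\mathbf C'$ is obtained from $\mathbf C$ by a step of the magic completion algorithm and $e$ is the newly added edge of $\mathbf C'$, then the label of $e$ is not $M$; (2) if $\mathbf C'$ is obtained from $\mathbf C$ by an inverse step of the magic completion algorithm and $e$ is the edge of $\mathbf C$ which was replaced by two edges (a fork) in $\mathbf C'$, then the label of $e$ is not $M$.
   Context: A $\delta$-edge-labelled cycle is a cycle graph (at least 3 vertices) with edge labels in $\{1,\dots,\delta\}$; $(c_1,\dots,c_k)$ denotes the cycle whose edges in cyclic order have labels $c_1,\dots,c_k$ (indices mod $k$). Two edges are neighbouring if they share a vertex. Parameters: integers with $3\le\delta<\infty$, $1\le K_1\le K_2\le\delta$, $2\delta+2\le C_0,C_1\le3\delta+2$, $C_0$ even, $C_1$ odd; $C=\min(C_0,C_1)$, $C'=\max(C_0,C_1)$. Admissible means either Case II: $C\le2\delta+K_1$, $C=2K_1+2K_2+1$, $K_1+K_2\ge\delta$, $K_1+2K_2\le2\delta-1$, and either (IIA) $C'=C+1$ or (IIB) $C'>C+1$, $K_1=K_2$, $3K_2=2\delta-1$; or Case III: $C>2\delta+K_1$, $K_1+2K_2\ge2\delta-1$, $3K_2\ge2\delta$, if $K_1+2K_2=2\delta-1$ then $C\ge2\delta+K_1+2$, if $C'>C+1$ then $C\ge2\delta+K_2$. Magic distance: $M\in\{1,\dots,\delta\}$ with $\max(K_1,\lceil\delta/2\rceil)\le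 M\le\min(K_2,\lfloor(C-\delta-1)/2\rfloor)$, such that moreover $M>K_1$ if Case III holds with $K_1+2K_2=2\delta-1$, and $M<K_2$ if Case III holds with $C'>C+1$ and $C=2\delta+K_2$. Operation: $x\oplus y=|x-y|$ if $|x-y|>M$; otherwise $\min(x+y,C-1-x-y)$ if this is $<M$; otherwise $M$. A cycle has a tension if it has two neighbouring edges with labels $a,b$ such that $a\oplus b\ne M$. Time function: $t(x)=2x+1$ if $x<M$, $t(x)=2(\delta-x)$ if $x>M$, $t(M)=\infty$; the magic permutation $d_1,\dots,d_\delta$ orders $\{1,\dots,\delta\}$ by increasing $t$. Step: for $\mathbf C=(c_1,\dots,c_k)$, $k\ge4$, let $i$ be minimal such that $c_j\oplus c_{j+1}=d_i$ for some $j$ ($c_{k+1}=c_1$); for any such $j$ the cycle $\mathbf C'$ with labels $c_1,\dots,c_{j-1},d_i,c_{j+2},\dots,c_k$ in cyclic order is obtained from $\mathbf C$ by a step, and $\mathbf C$ is obtained from $\mathbf C'$ by an inverse step. -}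

module Defs where

open import Data.Nat using (ℕ; zero; suc; _+_; _*_; _∸_; _≤_; _<_; _≥_; _>_; _⊓_; _⊔_; ⌈_/2⌉; ⌊_/2⌋; ∣_-_∣; _<ᵇ_; _%_; _≟_)
open import Data.Nat.DivMod using (m%n<n)
open import Data.Nat.Divisibility using (_∣_)
open import Data.Fin using (Fin; toℕ; fromℕ<)
open import Data.Bool using (if_then_else_)
open import Data.Product using (_×_; Σ; ∃; ∃-syntax)
open import Data.Sum using (_⊎_)
open import Relation.Nullary using (¬_; yes; no)
open import Relation.Binary.PropositionalEquality using (_≡_; _≢_)

Cmin Cmax : ℕ → ℕ → ℕ
Cmin C₀ C₁ = C₀ ⊓ C₁
Cmax C₀ C₁ = C₀ ⊔ C₁

Ranges : ℕ → ℕ → ℕ → ℕ → ℕ → Set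
Ranges δ K₁ K₂ C₀ C₁ =
  3 ≤ δ × 1 ≤ K₁ × K₁ ≤ K₂ × K₂ ≤ δ ×
  2 * δ + 2 ≤ C₀ × C₀ ≤ 3 * δ + 2 ×
  2 * δ + 2 ≤ C₁ × C₁ ≤ 3 * δ + 2 ×
  2 ∣ C₀ × ¬ (2 ∣ C₁)

-- Case II  (K₁ + 2K₂ ≤ 2δ - 1 written as K₁ + 2K₂ + 1 ≤ 2δ; 3K₂ = 2δ - 1 as 3K₂ + 1 = 2δ)
CaseII : ℕ → ℕ → ℕ → ℕ → ℕ → Set
CaseII δ K₁ K₂ C₀ C₁ =
  C ≤ 2 * δ + K₁ × C ≡ 2 * K₁ + 2 * K₂ + 1 × K₁ + K₂ ≥ δ ×
  K₁ + 2 * K₂ + 1 ≤ 2 * δ ×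
  (C' ≡ C + 1 ⊎ (C' > C + 1 × K₁ ≡ K₂ × 3 * K₂ + 1 ≡ 2 * δ))
  where C = Cmin C₀ C₁ ; C' = Cmax C₀ C₁

-- Case III  (K₁ + 2K₂ ≥ 2δ - 1 written as K₁ + 2K₂ + 1 ≥ 2δ)
CaseIII : ℕ → ℕ → ℕ → ℕ → ℕ → Set
CaseIII δ K₁ K₂ C₀ C₁ =
  C > 2 * δ + K₁ × K₁ + 2 * K₂ + 1 ≥ 2 * δ × 3 * K₂ ≥ 2 * δ ×
  (K₁ + 2 * K₂ + 1 ≡ 2 * δ → C ≥ 2 * δ + K₁ + 2) ×
  (C' > C + 1 → C ≥ 2 * δ + K₂)
  where C = Cmin C₀ C₁ ; C' = Cmax C₀ C₁

Admissible : ℕ → ℕ → ℕ → ℕ → ℕ → Set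
Admissible δ K₁ K₂ C₀ C₁ =
  Ranges δ K₁ K₂ C₀ C₁ × (CaseII δ K₁ K₂ C₀ C₁ ⊎ CaseIII δ K₁ K₂ C₀ C₁)

MagicDistance : ℕ → ℕ → ℕ → ℕ → ℕ → ℕ → Set
MagicDistance δ K₁ K₂ C₀ C₁ M =
  1 ≤ M × M ≤ δ ×
  K₁ ≤ M × ⌈ δ /2⌉ ≤ M × M ≤ K₂ × M ≤ ⌊ C ∸ δ ∸ 1 /2⌋ ×
  (CaseIII δ K₁ K₂ C₀ C₁ → K₁ + 2 * K₂ + 1 ≡ 2 * δ → K₁ < M) ×
  (CaseIII δ K₁ K₂ C₀ C₁ → C' > C + 1 → C ≡ 2 * δ + K₂ → M < K₂)
  where C = Cmin C₀ C₁ ; C' = Cmax C₀ C₁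

-- The operation x ⊕ y (depends on C and M).  (C ∸ 1 ∸ x ∸ y is truncated
-- subtraction; for labels in {1..δ} and C ≥ 2δ+2 it is never truncated.)

op : (C M x y : ℕ) → ℕ
op C M x y =
  if M <ᵇ ∣ x - y ∣ then ∣ x - y ∣
  else (if s <ᵇ M then s else M)
  where s = (x + y) ⊓ (C ∸ 1 ∸ x ∸ y)

data ℕ∞ : Set where
  fin : ℕ → ℕ∞
  ∞   : ℕ∞

data _<∞_ : ℕ∞ → ℕ∞ → Set where
  fin<fin : ∀ {a b} → a < b → fin a <∞ fin b
  fin<∞   : ∀ {a} → fin a <∞ ∞

time : (δ M x : ℕ) → ℕ∞
time δ M x =
  if x <ᵇ M then fin (2 * x + 1)
  else (if M <ᵇ x then fin (2 * (δ ∸ x)) else ∞)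

-- d : Fin δ → ℕ  (d i is d_{i+1}) lists {1,…,δ} in order of increasing t
MagicPermutation : (δ M : ℕ) → (Fin δ → ℕ) → Set
MagicPermutation δ M d =
  (∀ i → 1 ≤ d i × d i ≤ δ) ×
  (∀ x → 1 ≤ x → x ≤ δ → ∃[ i ] d i ≡ x) ×
  (∀ i j → toℕ i < toℕ j → time δ M (d i) <∞ time δ M (d j))

-- δ-edge-labelled cycles: k edges e₀,…,e_{k-1} in cyclic order, with
-- labels c : Fin k → ℕ; edge i and edge (i+1 mod k) are neighbouring.

IsLabelledCycle : (δ k : ℕ) → (Fin k → ℕ) → Set
IsLabelledCycle δ k c = 3 ≤ k × (∀ i → 1 ≤ c i × c i ≤ δ)

idx : (k : ℕ) → ℕ → Fin k → Fin k
idx (suc n) m _ = fromℕ< (m%n<n m (suc n))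

nxt : ∀ {k} → Fin k → Fin k
nxt {k} i = idx k (suc (toℕ i)) i

HasTension : (C M k : ℕ) → (Fin k → ℕ) → Set
HasTension C M k c = ∃[ i ] op C M (c i) (c (nxt i)) ≢ M

IsStepPosition : (C M δ : ℕ) → (Fin δ → ℕ) → (k : ℕ) → (Fin k → ℕ) → Fin k → Set
IsStepPosition C M δ d k c j =
  4 ≤ k ×
  Σ (Fin δ) λ i →
    op C M (c j) (c (nxt j)) ≡ d i ×
    (∀ i' j' → op C M (c j') (c (nxt j')) ≡ d i' → toℕ i ≤ toℕ i')

stepLabel : (C M k : ℕ) → (Fin k → ℕ) → Fin k → ℕ
stepLabel C M k c j = op C M (c j) (c (nxt j))

-- the cycle obtained by the step at j: new edge at position 0 (label d_i),
-- followed by c_{j+2}, …, c_{j+k-1} in cyclic order (length k - 1)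
stepCycle : (C M k : ℕ) → (Fin k → ℕ) → Fin k → Fin (k ∸ 1) → ℕ
stepCycle C M zero c ()
stepCycle C M (suc n) c j p with toℕ p
... | zero  = stepLabel C M (suc n) c j
... | suc q = c (idx (suc n) (toℕ j + 2 + q) j)

module Submission where

open import Defs
open import Data.Nat using (ℕ; _∸_)
open import Data.Fin using (Fin)
open import Data.Product using (_×_)
open import Relation.Binary.PropositionalEquality using (_≢_)

open import Data.Nat
  using (zero; suc; _+_; _*_; _≤_; _<_; _⊓_; ⌈_/2⌉; ⌊_/2⌋; ∣_-_∣; _<ᵇ_; _%_; _/_; s≤s; NonZero)
open import Data.Nat.Properties
open import Data.Nat.DivMod using (m≡m%n+[m/n]*n; [m+kn]%n≡m%n; m<n⇒m%n≡m; n%n≡0; m%n<n)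
open import Data.Fin using (toℕ)
open import Data.Fin.Properties using (toℕ-injective; toℕ-fromℕ<; toℕ<n)
open import Data.Bool using (true; false; T; if_then_else_)
open import Data.Unit using (tt)
open import Data.Product using (_,_; proj₁; proj₂)
open import Data.Sum using (inj₁; inj₂)
open import Data.Empty using (⊥-elim)
open import Relation.Nullary using (¬_)
open import Relation.Binary.PropositionalEquality
  using (_≡_; refl; sym; trans; cong; cong₂; subst; module ≡-Reasoning)

-- If a step adds an edge labelled M = d_i, then t(d_i) = ∞ exceeds every other time, so by
-- minimality of i every neighbouring pair of 𝐂 composes to d_i = M and 𝐂 has no tension; this is (1).
-- The bounds ⌈δ/2⌉ ≤ M ≤ ⌊(C-δ-1)/2⌋ make M absorbing, M ⊕ x = x ⊕ M = M, so in 𝐂' the two pairs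
-- through the new edge compose to M, and every other pair of 𝐂' is a neighbouring pair of 𝐂;
-- hence 𝐂' has no tension either, which is (2).

foldedSum : ℕ → ℕ → ℕ → ℕ
foldedSum C x y = (x + y) ⊓ (C ∸ 1 ∸ x ∸ y)

data OpView (C M x y : ℕ) : Set where
  distance : M < ∣ x - y ∣ → op C M x y ≡ ∣ x - y ∣ → OpView C M x y
  sum      : ∣ x - y ∣ ≤ M → foldedSum C x y < M → op C M x y ≡ foldedSum C x y → OpView C M x y
  magic    : ∣ x - y ∣ ≤ M → M ≤ foldedSum C x y → op C M x y ≡ M → OpView C M x y

<ᵇ≡false⇒≥ : ∀ {m n} → (m <ᵇ n) ≡ false → n ≤ m
<ᵇ≡false⇒≥ e = ≮⇒≥ λ lt → subst T e (<⇒<ᵇ lt)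

<ᵇ≡true⇒< : ∀ {m n} → (m <ᵇ n) ≡ true → m < n
<ᵇ≡true⇒< {m} {n} e = <ᵇ⇒< m n (subst T (sym e) tt)

if-true : ∀ {A : Set} {b} {u v : A} → b ≡ true → (if b then u else v) ≡ u
if-true refl = refl

if-false : ∀ {A : Set} {b} {u v : A} → b ≡ false → (if b then u else v) ≡ v
if-false refl = refl

opView : ∀ C M x y → OpView C M x y
opView C M x y with M <ᵇ ∣ x - y ∣ in far
... | true = distance (<ᵇ≡true⇒< far) (if-true far)
... | false with foldedSum C x y <ᵇ M in small
...   | true  = sum (<ᵇ≡false⇒≥ far) (<ᵇ≡true⇒< small) (trans (if-false far) (if-true small))
...   | false = magic (<ᵇ≡false⇒≥ far) (<ᵇ≡false⇒≥ small) (trans (if-false far) (if-false small))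

≤-foldedSum : ∀ {C a} x y → a ≤ x + y → a + suc (x + y) ≤ C → a ≤ foldedSum C x y
≤-foldedSum {C} {a} x y a≤x+y fits = ⊓-glb a≤x+y (subst (a ≤_) (sym complement) (m+n≤o⇒m≤o∸n a fits))
  where
  complement : C ∸ 1 ∸ x ∸ y ≡ C ∸ suc (x + y)
  complement = trans (∸-+-assoc (C ∸ 1) x y) (∸-+-assoc C 1 (x + y))

op-bounded : ∀ {C M δ x y} → 1 ≤ M → M ≤ δ → 2 * δ + 2 ≤ C →
             1 ≤ x → x ≤ δ → 1 ≤ y → y ≤ δ → 1 ≤ op C M x y × op C M x y ≤ δ
op-bounded {C} {M} {δ} {x} {y} 1≤M M≤δ room 1≤x x≤δ 1≤y y≤δ with opView C M x y
... | distance M<∣x-y∣ e rewrite e =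
      ≤-trans 1≤M (<⇒≤ M<∣x-y∣) , ≤-trans (∣m-n∣≤m⊔n x y) (⊔-lub x≤δ y≤δ)
... | sum _ s<M e rewrite e = ≤-foldedSum x y (≤-trans 1≤x (m≤m+n x y)) fits , ≤-trans (<⇒≤ s<M) M≤δ
  where
  fits : 1 + suc (x + y) ≤ C
  fits = ≤-trans (s≤s (s≤s (+-mono-≤ x≤δ y≤δ)))
                 (subst (_≤ C) (trans (+-comm (2 * δ) 2) (cong (λ t → 2 + (δ + t)) (+-identityʳ δ))) room)
... | magic _ _ e rewrite e = 1≤M , M≤δ

op-≡M : ∀ {C M} x y → ∣ x - y ∣ ≤ M → M ≤ x + y → M + suc (x + y) ≤ C → op C M x y ≡ M
op-≡M {C} {M} x y close M≤x+y fits with opView C M x y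
... | distance M<∣x-y∣ _ = ⊥-elim (≤⇒≯ close M<∣x-y∣)
... | sum _ s<M _        = ⊥-elim (<⇒≱ s<M (≤-foldedSum x y M≤x+y fits))
... | magic _ _ e        = e

⌈n/2⌉≤m⇒n≤m+m : ∀ {m} n → ⌈ n /2⌉ ≤ m → n ≤ m + m
⌈n/2⌉≤m⇒n≤m+m n ⌈n/2⌉≤m =
  subst (_≤ _) (⌊n/2⌋+⌈n/2⌉≡n n) (+-mono-≤ (≤-trans (⌊n/2⌋≤⌈n/2⌉ n) ⌈n/2⌉≤m) ⌈n/2⌉≤m)

m≤⌊n/2⌋⇒m+m≤n : ∀ {m} n → m ≤ ⌊ n /2⌋ → m + m ≤ n
m≤⌊n/2⌋⇒m+m≤n n m≤⌊n/2⌋ =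
  subst (_ ≤_) (⌊n/2⌋+⌈n/2⌉≡n n) (+-mono-≤ m≤⌊n/2⌋ (≤-trans m≤⌊n/2⌋ (⌊n/2⌋≤⌈n/2⌉ n)))

m≤n+n⇒∣n-m∣≤n : ∀ {m n} → m ≤ n + n → ∣ n - m ∣ ≤ n
m≤n+n⇒∣n-m∣≤n {m} {n} m≤n+n with ≤-total m n
... | inj₁ m≤n = subst (_≤ n) (sym (m≤n⇒∣n-m∣≡n∸m m≤n)) (m∸n≤m n m)
... | inj₂ n≤m = subst (_≤ n) (sym (m≤n⇒∣m-n∣≡n∸m n≤m)) (m≤n+o⇒m∸n≤o m n m≤n+n)

module Absorption {C M δ : ℕ} (δ≤M+M : δ ≤ M + M) (M+M+δ<C : M + M + δ < C) where

  private
    fits : ∀ {x} → x ≤ δ → M + suc (M + x) ≤ C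
    fits {x} x≤δ = begin
      M + suc (M + x) ≡⟨ +-suc M (M + x) ⟩
      suc (M + (M + x)) ≡⟨ cong suc (+-assoc M M x) ⟨
      suc (M + M + x) ≤⟨ s≤s (+-monoʳ-≤ (M + M) x≤δ) ⟩
      suc (M + M + δ) ≤⟨ M+M+δ<C ⟩
      C ∎
      where open ≤-Reasoning

  op-absorbingˡ : ∀ {x} → x ≤ δ → op C M M x ≡ M
  op-absorbingˡ {x} x≤δ = op-≡M M x (m≤n+n⇒∣n-m∣≤n (≤-trans x≤δ δ≤M+M)) (m≤m+n M x) (fits x≤δ)

  op-absorbingʳ : ∀ {x} → x ≤ δ → op C M x M ≡ M
  op-absorbingʳ {x} x≤δ =
    op-≡M x M (subst (_≤ M) (∣-∣-comm M x) (m≤n+n⇒∣n-m∣≤n (≤-trans x≤δ δ≤M+M)))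
              (m≤n+m M x) (subst (λ t → M + suc t ≤ C) (+-comm M x) (fits x≤δ))

m≤⌊c∸d∸1/2⌋⇒m+m+d<c : ∀ {C M δ} → 1 ≤ M → M ≤ ⌊ C ∸ δ ∸ 1 /2⌋ → M + M + δ < C
m≤⌊c∸d∸1/2⌋⇒m+m+d<c {C} {M} {δ} 1≤M M≤⌊⌋ =
  subst (_≤ C) (trans (cong (M + M +_) (+-comm δ 1)) (+-suc (M + M) δ))
        (m≤o∸n⇒m+n≤o (M + M) (<⇒≤ δ+1<C) M+M≤C∸[δ+1])
  where
  M+M≤C∸[δ+1] : M + M ≤ C ∸ (δ + 1)
  M+M≤C∸[δ+1] = subst (M + M ≤_) (∸-+-assoc C δ 1) (m≤⌊n/2⌋⇒m+m≤n (C ∸ δ ∸ 1) M≤⌊⌋)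

  δ+1<C : δ + 1 < C
  δ+1<C = m∸n≢0⇒n<m λ e → <⇒≱ (≤-trans 1≤M (m≤m+n M M)) (subst (M + M ≤_) e M+M≤C∸[δ+1])

n<ᵇn≡false : ∀ n → (n <ᵇ n) ≡ false
n<ᵇn≡false zero    = refl
n<ᵇn≡false (suc n) = n<ᵇn≡false n

time-M≡∞ : ∀ δ M → time δ M M ≡ ∞
time-M≡∞ δ M = trans (if-false (n<ᵇn≡false M)) (if-false (n<ᵇn≡false M))

∞-maximal : ∀ {t} → ¬ (∞ <∞ t)
∞-maximal ()

TensionFree : (C M k : ℕ) → (Fin k → ℕ) → Set
TensionFree C M k c = ∀ a → op C M (c a) (c (nxt a)) ≡ M

stepLabel≡M⇒tensionFree : ∀ {C M δ d k c j} → MagicPermutation δ M d →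
  (∀ a → 1 ≤ op C M (c a) (c (nxt a)) × op C M (c a) (c (nxt a)) ≤ δ) →
  IsStepPosition C M δ d k c j → stepLabel C M k c j ≡ M → TensionFree C M k c
stepLabel≡M⇒tensionFree {C} {M} {δ} {d} {c = c}
  (_ , onto , increasing) bounded (_ , i , label≡di , minimal) label≡M a
  with onto _ (proj₁ (bounded a)) (proj₂ (bounded a))
... | i′ , di′≡op with m≤n⇒m<n∨m≡n (minimal i′ a (sym di′≡op))
...   | inj₁ i<i′ = ⊥-elim (∞-maximal (subst (_<∞ time δ M (d i′)) time-di≡∞ (increasing i i′ i<i′)))
  where
  time-di≡∞ : time δ M (d i) ≡ ∞
  time-di≡∞ = trans (cong (time δ M) (trans (sym label≡di) label≡M)) (time-M≡∞ δ M)
...   | inj₂ i≡i′ = begin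
  op C M (c a) (c (nxt a)) ≡⟨ di′≡op ⟨
  d i′                     ≡⟨ cong d (toℕ-injective i≡i′) ⟨
  d i                      ≡⟨ trans (sym label≡di) label≡M ⟩
  M                        ∎
  where open ≡-Reasoning

toℕ-idx : ∀ n m (i : Fin (suc n)) → toℕ (idx (suc n) m i) ≡ m % suc n
toℕ-idx n m i = toℕ-fromℕ< (m%n<n m (suc n))

toℕ-nxt : ∀ {n} (i : Fin (suc n)) → toℕ (nxt i) ≡ suc (toℕ i) % suc n
toℕ-nxt {n} i = toℕ-idx n (suc (toℕ i)) i

suc-%-suc : ∀ m n .{{_ : NonZero n}} → suc m % n ≡ suc (m % n) % n
suc-%-suc m n = trans (cong (λ t → suc t % n) (m≡m%n+[m/n]*n m n)) ([m+kn]%n≡m%n (suc (m % n)) (m / n) n)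

nxt-idx : ∀ n m (i : Fin (suc n)) → nxt (idx (suc n) m i) ≡ idx (suc n) (suc m) i
nxt-idx n m i = toℕ-injective (begin
  toℕ (nxt (idx (suc n) m i))        ≡⟨ toℕ-nxt (idx (suc n) m i) ⟩
  suc (toℕ (idx (suc n) m i)) % suc n ≡⟨ cong (λ t → suc t % suc n) (toℕ-idx n m i) ⟩
  suc (m % suc n) % suc n             ≡⟨ suc-%-suc m (suc n) ⟨
  suc m % suc n                       ≡⟨ toℕ-idx n (suc m) i ⟨
  toℕ (idx (suc n) (suc m) i)         ∎)
  where open ≡-Reasoning

nxt-no-wrap : ∀ {k} (i : Fin k) → toℕ (nxt i) ≢ 0 → toℕ (nxt i) ≡ suc (toℕ i)
nxt-no-wrap {suc n} i no-wrap with m≤n⇒m<n∨m≡n (toℕ<n i)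
... | inj₁ 1+i<1+n = trans (toℕ-nxt i) (m<n⇒m%n≡m 1+i<1+n)
... | inj₂ 1+i≡1+n = ⊥-elim (no-wrap (trans (toℕ-nxt i) (trans (cong (_% suc n) 1+i≡1+n) (n%n≡0 (suc n)))))

module _ {C M n : ℕ} {c : Fin (suc n) → ℕ} {j : Fin (suc n)} where

  stepCycle-≤ : ∀ {δ} → stepLabel C M (suc n) c j ≤ δ → (∀ a → c a ≤ δ) →
                ∀ p → stepCycle C M (suc n) c j p ≤ δ
  stepCycle-≤ label≤δ c≤δ p with toℕ p
  ... | zero  = label≤δ
  ... | suc q = c≤δ _

  stepCycle-head : ∀ (p : Fin n) → toℕ p ≡ 0 → stepCycle C M (suc n) c j p ≡ stepLabel C M (suc n) c j
  stepCycle-head p e rewrite e = refl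

  stepCycle-tail : ∀ (p : Fin n) {q} → toℕ p ≡ suc q →
                   stepCycle C M (suc n) c j p ≡ c (idx (suc n) (toℕ j + 2 + q) j)
  stepCycle-tail p e rewrite e = refl

  data StepCycleNeighbours (p : Fin n) : Set where
    new-left  : stepCycle C M (suc n) c j p ≡ stepLabel C M (suc n) c j → StepCycleNeighbours p
    new-right : stepCycle C M (suc n) c j (nxt p) ≡ stepLabel C M (suc n) c j → StepCycleNeighbours p
    old       : ∀ a → stepCycle C M (suc n) c j p ≡ c a → stepCycle C M (suc n) c j (nxt p) ≡ c (nxt a) →
                StepCycleNeighbours p

  stepCycle-neighbours : ∀ p → StepCycleNeighbours p
  stepCycle-neighbours p = split (toℕ p) refl (toℕ (nxt p)) refl
    where
    split : ∀ t → toℕ p ≡ t → ∀ t′ → toℕ (nxt p) ≡ t′ → StepCycleNeighbours p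
    split zero    e _        _  = new-left (stepCycle-head p e)
    split (suc q) e zero     e′ = new-right (stepCycle-head (nxt p) e′)
    split (suc q) e (suc q′) e′ = old (idx (suc n) start j) (stepCycle-tail p e) next
      where
      start : ℕ
      start = toℕ j + 2 + q

      q′≡1+q : q′ ≡ suc q
      q′≡1+q = suc-injective (begin
        suc q′         ≡⟨ e′ ⟨
        toℕ (nxt p)    ≡⟨ nxt-no-wrap p (λ e″ → 0≢1+n (trans (sym e″) e′)) ⟩
        suc (toℕ p)    ≡⟨ cong suc e ⟩
        suc (suc q)    ∎)
        where open ≡-Reasoning

      next : stepCycle C M (suc n) c j (nxt p) ≡ c (nxt (idx (suc n) start j))
      next = begin
        stepCycle C M (suc n) c j (nxt p)       ≡⟨ stepCycle-tail (nxt p) e′ ⟩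
        c (idx (suc n) (toℕ j + 2 + q′) j)      ≡⟨ cong (λ t → c (idx (suc n) (toℕ j + 2 + t) j)) q′≡1+q ⟩
        c (idx (suc n) (toℕ j + 2 + suc q) j)   ≡⟨ cong (λ t → c (idx (suc n) t j)) (+-suc (toℕ j + 2) q) ⟩
        c (idx (suc n) (suc start) j)           ≡⟨ cong c (nxt-idx n start j) ⟨
        c (nxt (idx (suc n) start j))           ∎
        where open ≡-Reasoning

stepCycle-tensionFree : ∀ {C M δ n} {c : Fin (suc n) → ℕ} {j} →
  δ ≤ M + M → M + M + δ < C → M ≤ δ → (∀ a → c a ≤ δ) →
  stepLabel C M (suc n) c j ≡ M → TensionFree C M (suc n) c → TensionFree C M n (stepCycle C M (suc n) c j)
stepCycle-tensionFree {C} {M} {δ} {n} {c} {j} δ≤M+M M+M+δ<C M≤δ c≤δ label≡M free p =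
  neighbours (stepCycle-neighbours p)
  where
  open Absorption {C} {M} {δ} δ≤M+M M+M+δ<C

  sc : Fin n → ℕ
  sc = stepCycle C M (suc n) c j

  sc≤δ : ∀ q → sc q ≤ δ
  sc≤δ = stepCycle-≤ (subst (_≤ δ) (sym label≡M) M≤δ) c≤δ

  neighbours : StepCycleNeighbours {C} {M} {c = c} {j} p → op C M (sc p) (sc (nxt p)) ≡ M
  neighbours (new-left e)  =
    trans (cong (λ t → op C M t (sc (nxt p))) (trans e label≡M)) (op-absorbingˡ (sc≤δ (nxt p)))
  neighbours (new-right e) =
    trans (cong (op C M (sc p)) (trans e label≡M)) (op-absorbingʳ (sc≤δ p))
  neighbours (old a e e′)  = trans (cong₂ (op C M) e e′) (free a)

mainTheorem3 : (δ K₁ K₂ C₀ C₁ M : ℕ) →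
    Admissible δ K₁ K₂ C₀ C₁ → MagicDistance δ K₁ K₂ C₀ C₁ M →
    (d : Fin δ → ℕ) → MagicPermutation δ M d →
    ((k : ℕ) (c : Fin k → ℕ) → IsLabelledCycle δ k c →
       HasTension (Cmin C₀ C₁) M k c →
       (j : Fin k) → IsStepPosition (Cmin C₀ C₁) M δ d k c j →
       stepLabel (Cmin C₀ C₁) M k c j ≢ M)
    ×
    ((k : ℕ) (c' : Fin k → ℕ) → IsLabelledCycle δ k c' →
       (j : Fin k) → IsStepPosition (Cmin C₀ C₁) M δ d k c' j →
       HasTension (Cmin C₀ C₁) M (k ∸ 1) (stepCycle (Cmin C₀ C₁) M k c' j) →
       stepLabel (Cmin C₀ C₁) M k c' j ≢ M)
mainTheorem3 δ K₁ K₂ C₀ C₁ M ((_ , _ , _ , _ , 2δ+2≤C₀ , _ , 2δ+2≤C₁ , _) , _)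
             (1≤M , M≤δ , _ , ⌈δ/2⌉≤M , _ , M≤⌊C-δ-1/2⌋ , _) d permutation = step , inverseStep
  where
  C : ℕ
  C = Cmin C₀ C₁

  tensionFree : ∀ {k c j} → IsLabelledCycle δ k c → IsStepPosition C M δ d k c j →
                stepLabel C M k c j ≡ M → TensionFree C M k c
  tensionFree {c = c} {j} (_ , labels) = stepLabel≡M⇒tensionFree {C} {c = c} {j} permutation λ a →
    op-bounded 1≤M M≤δ (⊓-glb 2δ+2≤C₀ 2δ+2≤C₁)
      (proj₁ (labels a)) (proj₂ (labels a)) (proj₁ (labels (nxt a))) (proj₂ (labels (nxt a)))

  step : ∀ k c → IsLabelledCycle δ k c → HasTension C M k c →
         ∀ j → IsStepPosition C M δ d k c j → stepLabel C M k c j ≢ M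
  step _ _ cycle (a , tension) _ position label≡M = tension (tensionFree cycle position label≡M a)

  inverseStep : ∀ k c → IsLabelledCycle δ k c → ∀ j → IsStepPosition C M δ d k c j →
                HasTension C M (k ∸ 1) (stepCycle C M k c j) → stepLabel C M k c j ≢ M
  inverseStep (suc _) _ cycle _ position (p , tension) label≡M =
    tension (stepCycle-tensionFree (⌈n/2⌉≤m⇒n≤m+m δ ⌈δ/2⌉≤M) (m≤⌊c∸d∸1/2⌋⇒m+m+d<c 1≤M M≤⌊C-δ-1/2⌋)
                                   M≤δ (λ a → proj₂ (proj₂ cycle a)) label≡M
                                   (tensionFree cycle position label≡M) p)
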